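{- Let $\Gamma$ be a connected 5-valent vertex-transitive graph with $\omega(\Gamma)=4$. Then $\Gamma$ is irreducible. Furthermore, if the local graph of $\Gamma$ has a universal vertex, then $\Gamma$ admits a strong clique if and only if $\Gamma\cong C_4[K_2]$.
   Context: All graphs are finite and simple. $\omega$ denotes clique number. A graph is reducible if it has two distinct vertices with the same (open) neighbourhood, irreducible otherwise. The local graph of $\Gamma$ at a vertex $v$ is the subgraph induced by the neighbours of $v$ (for vertex-transitive $\Gamma$ all local graphs are isomorphic). A universal vertex is a vertex adjacent to all other vertices. A clique is strong if it intersects every inclusion-maximal independent set. $C_4[K_2]$ is the lexicographic product: vertex set $V(C_4)\times V(K_2)$, $(u,x)\sim(v,y)$ iff $uv\in E(C_4)$, or $u=v$ and $x\neq y$. A graph is vertex-transitive if its automorphism group acts transitively on its vertices. -}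

module Defs where

open import Data.Nat using (ℕ; _≤_)
open import Data.Fin using (Fin; zero; suc; remQuot; _≟_)
open import Data.Fin.Subset using (Subset; _∈_; _∉_; _⊆_; ∣_∣)
open import Data.List using (length; filter)
open import Data.List.Base using ()
open import Data.Fin.Base using ()
open import Data.List using (List)
open import Data.Vec.Functional using ()
open import Data.Product using (Σ; ∃; ∃-syntax; _×_; _,_; proj₁; proj₂)
open import Data.Sum using (_⊎_)
open import Data.Bool using (Bool; true; false; T)
open import Relation.Nullary using (¬_)
open import Relation.Binary using (Decidable)
open import Relation.Binary.PropositionalEquality using (_≡_; _≢_)
open import Function.Bundles using (_⇔_; _↔_; Inverse)
open import Data.List using (allFin) renaming ()

record Graph : Set₁ where
  field
    n     : ℕ
    Adj   : Fin n → Fin n → Set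
    adj?  : Decidable Adj
    sym   : ∀ {u v} → Adj u v → Adj v u
    irrefl : ∀ {u} → ¬ Adj u u

module _ (G : Graph) where
  open Graph G

  degree : Fin n → ℕ
  degree v = length (filter (adj? v) (allFin n))

  Regular : ℕ → Set
  Regular k = ∀ v → degree v ≡ k

  data Reachable : Fin n → Fin n → Set where
    here : ∀ {u} → Reachable u u
    step : ∀ {u v w} → Adj u v → Reachable v w → Reachable u w

  Connected : Set
  Connected = ∀ u v → Reachable u v

  IsAutomorphism : (Fin n ↔ Fin n) → Set
  IsAutomorphism σ = ∀ u v → Adj u v ⇔ Adj (Inverse.to σ u) (Inverse.to σ v)

  VertexTransitive : Set
  VertexTransitive = ∀ u v → Σ (Fin n ↔ Fin n) λ σ → IsAutomorphism σ × Inverse.to σ u ≡ v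

  IsClique : Subset n → Set
  IsClique S = ∀ u v → u ∈ S → v ∈ S → u ≢ v → Adj u v

  IsIndependent : Subset n → Set
  IsIndependent S = ∀ u v → u ∈ S → v ∈ S → ¬ Adj u v

  IsMaximalIndependent : Subset n → Set
  IsMaximalIndependent S = IsIndependent S × (∀ T → IsIndependent T → S ⊆ T → T ⊆ S)

  CliqueNumber : ℕ → Set
  CliqueNumber k = (Σ (Subset n) λ S → IsClique S × ∣ S ∣ ≡ k) × (∀ S → IsClique S → ∣ S ∣ ≤ k)

  IsStrongClique : Subset n → Set
  IsStrongClique C = IsClique C × (∀ I → IsMaximalIndependent I → ∃[ v ] (v ∈ C × v ∈ I))

  HasStrongClique : Set
  HasStrongClique = ∃[ C ] IsStrongClique C

  Reducible : Set
  Reducible = ∃[ u ] ∃[ v ] (u ≢ v × (∀ w → Adj u w ⇔ Adj v w))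

  Irreducible : Set
  Irreducible = ¬ Reducible

  -- the local graph at v (induced on the neighbours of v) has a universal vertex:
  -- some neighbour u of v adjacent to every other neighbour of v
  LocalGraphHasUniversalVertex : Fin n → Set
  LocalGraphHasUniversalVertex v = ∃[ u ] (Adj v u × (∀ w → Adj v w → w ≢ u → Adj u w))

_≅_ : Graph → Graph → Set
G ≅ H = Σ (Fin (Graph.n G) ↔ Fin (Graph.n H)) λ φ →
          ∀ u v → Graph.Adj G u v ⇔ Graph.Adj H (Inverse.to φ u) (Inverse.to φ v)

-- the 4-cycle 0-1-2-3-0
c4adj : Fin 4 → Fin 4 → Bool
c4adj zero (suc zero) = true
c4adj zero (suc (suc (suc zero))) = true
c4adj (suc zero) zero = true
c4adj (suc zero) (suc (suc zero)) = true
c4adj (suc (suc zero)) (suc zero) = true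
c4adj (suc (suc zero)) (suc (suc (suc zero))) = true
c4adj (suc (suc (suc zero))) (suc (suc zero)) = true
c4adj (suc (suc (suc zero))) zero = true
c4adj _ _ = false

module _ where
  open import Data.Bool.Properties using (T?)
  open import Relation.Nullary using (yes; no)
  open import Relation.Nullary.Decidable using (_⊎-dec_; _×-dec_; ¬?)

  C4 : Graph
  C4 = record
    { n = 4 ; Adj = λ u v → T (c4adj u v) ; adj? = λ u v → T? (c4adj u v)
    ; sym = λ {u} {v} → s u v ; irrefl = λ {u} → i u }
    where
      s : ∀ u v → T (c4adj u v) → T (c4adj v u)
      s zero (suc zero) t = t
      s zero (suc (suc (suc zero))) t = t
      s (suc zero) zero t = t
      s (suc zero) (suc (suc zero)) t = t
      s (suc (suc zero)) (suc zero) t = t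
      s (suc (suc zero)) (suc (suc (suc zero))) t = t
      s (suc (suc (suc zero))) (suc (suc zero)) t = t
      s (suc (suc (suc zero))) zero t = t
      i : ∀ u → ¬ T (c4adj u u)
      i zero ()
      i (suc zero) ()
      i (suc (suc zero)) ()
      i (suc (suc (suc zero))) ()

  K2 : Graph
  K2 = record
    { n = 2 ; Adj = λ u v → u ≢ v ; adj? = λ u v → ¬? (u ≟ v)
    ; sym = λ p q → p (Relation.Binary.PropositionalEquality.sym q)
    ; irrefl = λ p → p Relation.Binary.PropositionalEquality.refl }

  -- lexicographic product G[H] on Fin (|G| * |H|), vertex i ↦ (remQuot i) ∈ V(G) × V(H):
  -- (u,x) ~ (v,y) iff u ~ v in G, or u = v and x ~ y in H
  Lex : Graph → Graph → Graph
  Lex G H = record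
    { n = Graph.n G Data.Nat.* Graph.n H
    ; Adj = A ; adj? = d ; sym = λ {i} {j} → sy i j ; irrefl = λ {i} → ir i }
    where
      open import Data.Nat using (_*_)
      module G = Graph G
      module H = Graph H
      rq = remQuot {Graph.n G} (Graph.n H)
      A : Fin (Graph.n G * Graph.n H) → Fin (Graph.n G * Graph.n H) → Set
      A i j = G.Adj (proj₁ (rq i)) (proj₁ (rq j))
              ⊎ (proj₁ (rq i) ≡ proj₁ (rq j) × H.Adj (proj₂ (rq i)) (proj₂ (rq j)))
      d : Decidable A
      d i j = G.adj? _ _ ⊎-dec ((proj₁ (rq i) ≟ proj₁ (rq j)) ×-dec H.adj? _ _)
      sy : ∀ i j → A i j → A j i
      sy i j (Data.Sum.inj₁ a) = Data.Sum.inj₁ (G.sym a)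
      sy i j (Data.Sum.inj₂ (e , a)) =
        Data.Sum.inj₂ (Relation.Binary.PropositionalEquality.sym e , H.sym a)
      ir : ∀ i → ¬ A i i
      ir i (Data.Sum.inj₁ a) = G.irrefl a
      ir i (Data.Sum.inj₂ (_ , a)) = H.irrefl a

C4[K2] : Graph
C4[K2] = Lex C4 K2

-- If two vertices have the same neighbourhood, vertex-transitivity gives every vertex such an
-- open twin; a vertex of a 4-clique is then adjacent to the other three and to their three
-- (distinct) twins, six neighbours in a 5-regular graph.
--
-- If the local graph at v has a universal vertex u, then N[v] ⊆ N[u], and regularity forces
-- N[v] = N[u]. So the vertices fall into classes of closed twins, each of size exactly two since
-- ω ≤ 4, and N(c) = {c′} ∪ {x, x′} ∪ {y, y′} with x ≁ y. A strong clique C through c lies in N[c]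
-- and misses the class of x or of y, say of y. For a neighbour z of x outside N[c], every vertex
-- of C is adjacent to y or to z; extending {y, z} to a maximal independent set shows y ∼ z. The
-- induced square c x z y, blown up by the twin classes, is an injective homomorphism
-- C4[K2] → Γ between 5-regular graphs with Γ connected, hence an isomorphism. Conversely, two
-- adjacent blocks of C4[K2] form a strong clique.

module Submission where

open import Defs
open import Data.Product using (_×_)
open import Function.Bundles using (_⇔_)
open import Data.Fin using (Fin)

open import Data.Nat using (ℕ; suc; _≤_; _<_; _<?_; z≤n; s≤s)
import Data.Nat as ℕ
open import Data.Nat.Properties using (≤-<-trans; ≤-trans; <⇒≱; <-irrefl)
open import Data.Fin using (zero; suc; #_; remQuot; combine)
open import Data.Fin.Subset using (Subset; _∈_; _∉_; _⊆_; ∣_∣; ⁅_⁆; _∪_; ⊥; inside; outside)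
open import Data.Fin.Subset.Properties using (_∈?_; x∈p∪q⁻; x∈p∪q⁺; x∈⁅x⁆; x∈⁅y⁆⇒x≡y; ∉⊥; p⊂q⇒∣p∣<∣q∣)
import Data.Vec as Vec
open import Data.List using (List; []; _∷_; _++_; length; filter; map; allFin)
open import Data.List.Properties using (filter-notAll; length-map)
open import Data.List.Relation.Unary.Any using (Any; here; there)
import Data.List.Relation.Unary.Any as Any
open import Data.List.Relation.Unary.All using (All; []; _∷_)
import Data.List.Relation.Unary.All as All
import Data.List.Relation.Unary.All.Properties as All
import Data.List.Relation.Unary.AllPairs as AllPairs
import Data.List.Relation.Unary.AllPairs.Properties as AllPairs
open import Data.List.Relation.Unary.AllPairs using (AllPairs; []; _∷_)
open import Data.List.Relation.Unary.Unique.Propositional using (Unique)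
import Data.List.Relation.Unary.Unique.Propositional.Properties as Unique
open import Data.List.Membership.Propositional using () renaming (_∈_ to _∈ₗ_; _∉_ to _∉ₗ_)
open import Data.List.Membership.Propositional.Properties using (∈-filter⁺; ∈-filter⁻; ∈-map⁻; ∈-allFin)
open import Data.List.Relation.Binary.Subset.Propositional using () renaming (_⊆_ to _⊆ₗ_)
open import Data.Product using (Σ; _,_; proj₁; proj₂; ∃-syntax; uncurry)
open import Data.Sum using (_⊎_; inj₁; inj₂; [_,_]′)
open import Data.Bool using (T)
open import Data.Empty using (⊥-elim) renaming (⊥ to Empty)
open import Relation.Nullary using (¬_; Dec; yes; no)
open import Relation.Nullary.Decidable using (¬?; _×-dec_; _⊎-dec_; _→-dec_; from-yes)
open import Relation.Nullary.Negation using (contradiction)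
open import Relation.Binary using (DecidableEquality)
open import Relation.Binary.PropositionalEquality using (_≡_; _≢_; refl; sym; trans; cong; subst; subst₂)
open import Function.Bundles using (mk⇔; mk↔ₛ′; Equivalence; Inverse)
open import Data.Fin.Properties using (suc-injective; _≟_; any?; all?; combine-remQuot)
open import Data.Vec.Properties using ([]=⇒lookup; lookup⇒[]=; lookup∘tabulate)
open import Function using (_∘_; id)

module _ {a} {A : Set a} (_≟_ : DecidableEquality A) where

  length-mono-⊆ : {xs ys : List A} → Unique xs → xs ⊆ₗ ys → length xs ≤ length ys
  length-mono-⊆ {[]} _ _ = z≤n
  length-mono-⊆ {x ∷ xs} {ys} (x∉xs ∷ xs!) x∷xs⊆ys =
    ≤-<-trans (length-mono-⊆ xs! xs⊆ys-x) (filter-notAll ≢x? ys x∈ys)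
    where
    ≢x? : ∀ z → Dec (z ≢ x)
    ≢x? z = ¬? (z ≟ x)
    xs⊆ys-x : xs ⊆ₗ filter ≢x? ys
    xs⊆ys-x z∈xs = ∈-filter⁺ ≢x? (x∷xs⊆ys (there z∈xs)) λ { refl → All.lookup x∉xs z∈xs refl }
    x∈ys : Any (λ z → ¬ z ≢ x) ys
    x∈ys = Any.map (λ { refl ¬¬ → ¬¬ refl }) (x∷xs⊆ys (here refl))

module _ {a} {A : Set a} where

  infixr 5 _∷!_
  _∷!_ : ∀ {w : A} {xs} → w ∉ₗ xs → Unique xs → Unique (w ∷ xs)
  w∉xs ∷! xs! = All.¬Any⇒All¬ _ w∉xs ∷ xs!

  ∈-∉⇒≢ : ∀ {x w : A} {xs} → x ∈ₗ xs → w ∉ₗ xs → x ≢ w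
  ∈-∉⇒≢ x∈ w∉ refl = w∉ x∈

module _ {a ℓ} {A : Set a} {R : A → A → Set ℓ} where

  AllPairs-lookup : (∀ {x y} → R x y → R y x) → ∀ {xs x y} →
                    AllPairs R xs → x ∈ₗ xs → y ∈ₗ xs → x ≢ y → R x y
  AllPairs-lookup R-sym (_ ∷ _) (here refl) (here refl) x≢y = ⊥-elim (x≢y refl)
  AllPairs-lookup R-sym (Rx ∷ _) (here refl) (there y∈) x≢y = All.lookup Rx y∈
  AllPairs-lookup R-sym (Rx ∷ _) (there x∈) (here refl) x≢y = R-sym (All.lookup Rx x∈)
  AllPairs-lookup R-sym (_ ∷ Rxs) (there x∈) (there y∈) x≢y = AllPairs-lookup R-sym Rxs x∈ y∈ x≢y

  AllPairs-fromUnique : ∀ {xs} → Unique xs → (∀ {x y} → x ∈ₗ xs → y ∈ₗ xs → x ≢ y → R x y) → AllPairs R xs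
  AllPairs-fromUnique [] R-xs = []
  AllPairs-fromUnique (x∉xs ∷ xs!) R-xs =
    All.tabulate (λ y∈ → R-xs (here refl) (there y∈) (All.lookup x∉xs y∈))
    ∷ AllPairs-fromUnique xs! (λ x∈ y∈ → R-xs (there x∈) (there y∈))

elements : ∀ {n} → Subset n → List (Fin n)
elements Vec.[] = []
elements (inside Vec.∷ p) = zero ∷ map suc (elements p)
elements (outside Vec.∷ p) = map suc (elements p)

length-elements : ∀ {n} (p : Subset n) → length (elements p) ≡ ∣ p ∣
length-elements Vec.[] = refl
length-elements (inside Vec.∷ p) = cong suc (trans (length-map suc (elements p)) (length-elements p))
length-elements (outside Vec.∷ p) = trans (length-map suc (elements p)) (length-elements p)

∈-elements⁻ : ∀ {n} (p : Subset n) {x} → x ∈ₗ elements p → x ∈ p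
∈-elements⁻ (inside Vec.∷ p) (here refl) = Vec.here
∈-elements⁻ (inside Vec.∷ p) (there x∈) with ∈-map⁻ suc x∈
... | _ , y∈ , refl = Vec.there (∈-elements⁻ p y∈)
∈-elements⁻ (outside Vec.∷ p) x∈ with ∈-map⁻ suc x∈
... | _ , y∈ , refl = Vec.there (∈-elements⁻ p y∈)

elements-unique : ∀ {n} (p : Subset n) → Unique (elements p)
elements-unique Vec.[] = []
elements-unique (inside Vec.∷ p) = All.tabulate zero∉ ∷ Unique.map⁺ suc-injective (elements-unique p)
  where
  zero∉ : ∀ {x} → x ∈ₗ map suc (elements p) → zero ≢ x
  zero∉ x∈ refl with ∈-map⁻ suc x∈
  ... | _ , _ , ()
elements-unique (outside Vec.∷ p) = Unique.map⁺ suc-injective (elements-unique p)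

fromList : ∀ {n} → List (Fin n) → Subset n
fromList [] = ⊥
fromList (x ∷ xs) = ⁅ x ⁆ ∪ fromList xs

∈-fromList⁻ : ∀ {n} {x : Fin n} (xs : List (Fin n)) → x ∈ fromList xs → x ∈ₗ xs
∈-fromList⁻ [] x∈ = ⊥-elim (∉⊥ x∈)
∈-fromList⁻ (y ∷ xs) x∈ with x∈p∪q⁻ ⁅ y ⁆ (fromList xs) x∈
... | inj₁ x∈y = here (x∈⁅y⁆⇒x≡y y x∈y)
... | inj₂ x∈xs = there (∈-fromList⁻ xs x∈xs)

length≤∣fromList∣ : ∀ {n} {xs : List (Fin n)} → Unique xs → length xs ≤ ∣ fromList xs ∣
length≤∣fromList∣ {xs = []} _ = z≤n
length≤∣fromList∣ {xs = x ∷ xs} (x∉xs ∷ xs!) =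
  ≤-<-trans (length≤∣fromList∣ xs!) (p⊂q⇒∣p∣<∣q∣ (x∈p∪q⁺ ∘ inj₂ , x , x∈p∪q⁺ (inj₁ (x∈⁅x⁆ x)) , x∉))
  where
  x∉ : ¬ x ∈ fromList xs
  x∉ x∈ = All.lookup x∉xs (∈-fromList⁻ xs x∈) refl

module Neighbourhood (Γ : Graph) where
  open Graph Γ renaming (sym to Adj-sym)

  Adj⇒≢ : ∀ {u w} → Adj u w → u ≢ w
  Adj⇒≢ uw refl = irrefl uw

  neighbours : Fin n → List (Fin n)
  neighbours v = filter (adj? v) (allFin n)

  neighbours-unique : ∀ v → Unique (neighbours v)
  neighbours-unique v = Unique.filter⁺ (adj? v) (Unique.allFin⁺ n)

  ∈-neighbours⁺ : ∀ {v w} → Adj v w → w ∈ₗ neighbours v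
  ∈-neighbours⁺ {v} = ∈-filter⁺ (adj? v) (∈-allFin _)

  ∈-neighbours⁻ : ∀ {v w} → w ∈ₗ neighbours v → Adj v w
  ∈-neighbours⁻ {v} w∈ = proj₂ (∈-filter⁻ (adj? v) {xs = allFin n} w∈)

  _∈N[_] : Fin n → Fin n → Set
  w ∈N[ v ] = v ≡ w ⊎ Adj v w

  _∉N[_] : Fin n → Fin n → Set
  w ∉N[ v ] = ¬ w ∈N[ v ]

  ∈N-sym : ∀ {v w} → w ∈N[ v ] → v ∈N[ w ]
  ∈N-sym (inj₁ refl) = inj₁ refl
  ∈N-sym (inj₂ vw) = inj₂ (Adj-sym vw)

  ∉N-sym : ∀ {v w} → w ∉N[ v ] → v ∉N[ w ]
  ∉N-sym w∉ v∈ = w∉ (∈N-sym v∈)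

module ClosedTwins (Γ : Graph) where
  open Graph Γ renaming (sym to Adj-sym)
  open Neighbourhood Γ

  infix 4 _≈_
  _≈_ : Fin n → Fin n → Set
  u ≈ v = ∀ w → w ∈N[ u ] ⇔ w ∈N[ v ]

  ≈-refl : ∀ {u} → u ≈ u
  ≈-refl w = mk⇔ id id

  ≈-sym : ∀ {u v} → u ≈ v → v ≈ u
  ≈-sym u≈v w = mk⇔ (Equivalence.from (u≈v w)) (Equivalence.to (u≈v w))

  ≈-trans : ∀ {u v w} → u ≈ v → v ≈ w → u ≈ w
  ≈-trans u≈v v≈w x = mk⇔ (Equivalence.to (v≈w x) ∘ Equivalence.to (u≈v x))
                          (Equivalence.from (u≈v x) ∘ Equivalence.from (v≈w x))

  ∈N-resp-≈ : ∀ {u u' w} → u ≈ u' → w ∈N[ u ] → w ∈N[ u' ]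
  ∈N-resp-≈ {w = w} u≈u' = Equivalence.to (u≈u' w)

  ≈⇒∈N : ∀ {u v} → u ≈ v → v ∈N[ u ]
  ≈⇒∈N u≈v = ∈N-resp-≈ (≈-sym u≈v) (inj₁ refl)

  ≈⇒≢⇒Adj : ∀ {u v} → u ≈ v → u ≢ v → Adj u v
  ≈⇒≢⇒Adj u≈v u≢v with ≈⇒∈N u≈v
  ... | inj₁ u≡v = ⊥-elim (u≢v u≡v)
  ... | inj₂ uv = uv

  ≈-Adj : ∀ {u u' w} → u ≈ u' → Adj u w → u' ≢ w → Adj u' w
  ≈-Adj u≈u' uw u'≢w with ∈N-resp-≈ u≈u' (inj₂ uw)
  ... | inj₁ u'≡w = ⊥-elim (u'≢w u'≡w)
  ... | inj₂ u'w = u'w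

  ≉⇒≢ : ∀ {u v u' v'} → ¬ u ≈ v → u ≈ u' → v ≈ v' → u' ≢ v'
  ≉⇒≢ u≉v u≈u' v≈v' refl = u≉v (≈-trans u≈u' (≈-sym v≈v'))

  Adj-resp-≈ : ∀ {u v u' v'} → ¬ u ≈ v → u ≈ u' → v ≈ v' → Adj u v → Adj u' v'
  Adj-resp-≈ u≉v u≈u' v≈v' uv with ∈N-resp-≈ u≈u' (inj₂ uv)
  ... | inj₁ u'≡v = ⊥-elim (≉⇒≢ u≉v u≈u' ≈-refl u'≡v)
  ... | inj₂ u'v with ∈N-resp-≈ v≈v' (inj₂ (Adj-sym u'v))
  ...   | inj₁ v'≡u' = ⊥-elim (≉⇒≢ u≉v u≈u' v≈v' (sym v'≡u'))
  ...   | inj₂ v'u' = Adj-sym v'u'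

  ∉N-resp-≈ : ∀ {u v u' v'} → u ≈ u' → v ≈ v' → v ∉N[ u ] → v' ∉N[ u' ]
  ∉N-resp-≈ u≈u' v≈v' v∉ v'∈ =
    v∉ (∈N-resp-≈ (≈-sym u≈u') (∈N-sym (∈N-resp-≈ (≈-sym v≈v') (∈N-sym v'∈))))

module OpenTwins (Γ : Graph) where
  open Graph Γ renaming (sym to Adj-sym)

  OpenTwins : Fin n → Fin n → Set
  OpenTwins u v = ∀ w → Adj u w ⇔ Adj v w

  automorphism-preserves-OpenTwins : ∀ {σ u v} → IsAutomorphism Γ σ → OpenTwins u v →
                                     OpenTwins (Inverse.to σ u) (Inverse.to σ v)
  automorphism-preserves-OpenTwins {σ} {u} {v} σ-aut u≈v w =
    mk⇔ (pull v ∘ Equivalence.to (u≈v w₀) ∘ push u) (pull u ∘ Equivalence.from (u≈v w₀) ∘ push v)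
    where
    w₀ : Fin n
    w₀ = Inverse.from σ w
    σw₀≡w : Inverse.to σ w₀ ≡ w
    σw₀≡w = Inverse.strictlyInverseˡ σ w
    push : ∀ x → Adj (Inverse.to σ x) w → Adj x w₀
    push x = Equivalence.from (σ-aut x w₀) ∘ subst (Adj (Inverse.to σ x)) (sym σw₀≡w)
    pull : ∀ x → Adj x w₀ → Adj (Inverse.to σ x) w
    pull x = subst (Adj (Inverse.to σ x)) σw₀≡w ∘ Equivalence.to (σ-aut x w₀)

  reducible⇒everywhere-OpenTwins : VertexTransitive Γ → Reducible Γ →
                                   ∀ a → ∃[ a' ] (a ≢ a' × OpenTwins a a')
  reducible⇒everywhere-OpenTwins vt (u , v , u≢v , u≈v) a with vt u a
  ... | σ , σ-aut , refl = Inverse.to σ v , σu≢σv , automorphism-preserves-OpenTwins {σ} σ-aut u≈v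
    where
    σu≢σv : Inverse.to σ u ≢ Inverse.to σ v
    σu≢σv eq = u≢v (trans (sym (Inverse.strictlyInverseʳ σ u))
                     (trans (cong (Inverse.from σ) eq) (Inverse.strictlyInverseʳ σ v)))

module Cliques (Γ : Graph) where
  open Graph Γ renaming (sym to Adj-sym)
  open Neighbourhood Γ

  clique-length≤ : ∀ {ω} → (∀ S → IsClique Γ S → ∣ S ∣ ≤ ω) → ∀ {xs} → AllPairs Adj xs → length xs ≤ ω
  clique-length≤ bound {xs} xs-clique =
    ≤-trans (length≤∣fromList∣ (AllPairs.map Adj⇒≢ xs-clique)) (bound (fromList xs) fromList-clique)
    where
    fromList-clique : IsClique Γ (fromList xs)
    fromList-clique u v u∈ v∈ = AllPairs-lookup Adj-sym xs-clique (∈-fromList⁻ xs u∈) (∈-fromList⁻ xs v∈)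

  clique-∈N : ∀ {S u w} → IsClique Γ S → u ∈ S → w ∈ S → w ∈N[ u ]
  clique-∈N {u = u} {w} S-clique u∈S w∈S with u ≟ w
  ... | yes u≡w = inj₁ u≡w
  ... | no u≢w = inj₂ (S-clique u w u∈S w∈S u≢w)

  elements-clique : ∀ {S} → IsClique Γ S → AllPairs Adj (elements S)
  elements-clique {S} S-clique = AllPairs-fromUnique (elements-unique S)
    (λ u∈ v∈ → S-clique _ _ (∈-elements⁻ S u∈) (∈-elements⁻ S v∈))

module RegularGraph (Γ : Graph) {k : ℕ} (regular : Regular Γ k) where
  open Graph Γ renaming (sym to Adj-sym)
  open Neighbourhood Γ
  open ClosedTwins Γ
  open OpenTwins Γ
  open Cliques Γ using (elements-clique)
  open import Data.List.Membership.DecPropositional (_≟_ {n}) using () renaming (_∈?_ to _∈ₗ?_)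

  length≤degree : ∀ {v xs} → Unique xs → All (Adj v) xs → length xs ≤ k
  length≤degree {v} xs! v~xs =
    subst (_ ≤_) (regular v) (length-mono-⊆ _≟_ xs! (∈-neighbours⁺ ∘ All.lookup v~xs))

  neighbours-exhausted : ∀ {v w xs} → Unique xs → All (Adj v) xs → length xs ≡ k → Adj v w → w ∈ₗ xs
  neighbours-exhausted {w = w} {xs} xs! v~xs refl vw with w ∈ₗ? xs
  ... | yes w∈xs = w∈xs
  ... | no w∉xs = contradiction (length≤degree (w∉xs ∷! xs!) (vw ∷ v~xs)) (<-irrefl refl)

  fresh-neighbour : ∀ {v xs} → Unique xs → All (Adj v) xs → length xs < k → ∃[ w ] (Adj v w × w ∉ₗ xs)
  fresh-neighbour {v} {xs} xs! v~xs short with any? (λ w → adj? v w ×-dec ¬? (w ∈ₗ? xs))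
  ... | yes found = found
  ... | no none =
    contradiction (subst (_≤ length xs) (regular v) (length-mono-⊆ _≟_ (neighbours-unique v) N⊆xs))
                  (<⇒≱ short)
    where
    N⊆xs : neighbours v ⊆ₗ xs
    N⊆xs {w} w∈N with w ∈ₗ? xs
    ... | yes w∈xs = w∈xs
    ... | no w∉xs = ⊥-elim (none (w , ∈-neighbours⁻ w∈N , w∉xs))

  closed-length≤ : ∀ {u xs} → Unique xs → All (_∈N[ u ]) xs → length xs ≤ suc k
  closed-length≤ {u} xs! u∋xs =
    subst (λ d → _ ≤ suc d) (regular u) (length-mono-⊆ _≟_ xs! (∈N⇒∈ ∘ All.lookup u∋xs))
    where
    ∈N⇒∈ : ∀ {w} → w ∈N[ u ] → w ∈ₗ u ∷ neighbours u
    ∈N⇒∈ (inj₁ refl) = here refl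
    ∈N⇒∈ (inj₂ uw) = there (∈-neighbours⁺ uw)

  closed-nbhd-⊆⇒≈ : ∀ {u v} → (∀ {w} → w ∈N[ v ] → w ∈N[ u ]) → v ≈ u
  closed-nbhd-⊆⇒≈ {u} {v} N[v]⊆N[u] w = mk⇔ N[v]⊆N[u] N[u]⊆N[v]
    where
    N[u]⊆N[v] : w ∈N[ u ] → w ∈N[ v ]
    N[u]⊆N[v] w∈N[u] with (v ≟ w) ⊎-dec (adj? v w)
    ... | yes w∈N[v] = w∈N[v]
    ... | no w∉N[v] =
      ⊥-elim (<-irrefl refl (subst (λ d → suc (suc d) ≤ suc k) (regular v) (closed-length≤ {u} uniq members)))
      where
      w∉ : w ∉ₗ v ∷ neighbours v
      w∉ (here refl) = w∉N[v] (inj₁ refl)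
      w∉ (there w∈N) = w∉N[v] (inj₂ (∈-neighbours⁻ w∈N))
      uniq : Unique (w ∷ v ∷ neighbours v)
      uniq = w∉ ∷! (irrefl ∘ ∈-neighbours⁻) ∷! neighbours-unique v
      members : All (_∈N[ u ]) (w ∷ v ∷ neighbours v)
      members = w∈N[u] ∷ N[v]⊆N[u] (inj₁ refl) ∷ All.tabulate (N[v]⊆N[u] ∘ inj₂ ∘ ∈-neighbours⁻)

  universal⇒closed-twin : ∀ {v} → LocalGraphHasUniversalVertex Γ v → ∃[ u ] (v ≢ u × v ≈ u)
  universal⇒closed-twin {v} (u , vu , u-universal) = u , Adj⇒≢ vu , closed-nbhd-⊆⇒≈ N[v]⊆N[u]
    where
    N[v]⊆N[u] : ∀ {w} → w ∈N[ v ] → w ∈N[ u ]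
    N[v]⊆N[u] (inj₁ refl) = inj₂ (Adj-sym vu)
    N[v]⊆N[u] {w} (inj₂ vw) with u ≟ w
    ... | yes u≡w = inj₁ u≡w
    ... | no u≢w = inj₂ (u-universal w vw (u≢w ∘ sym))

  twin-doubled-clique-bound : (op : Fin n → Fin n) → (∀ a → a ≢ op a × OpenTwins a (op a)) →
                              ∀ {a xs} → AllPairs Adj (a ∷ xs) → length (map op xs ++ xs) ≤ k
  twin-doubled-clique-bound op twin {a} {xs} (a~xs ∷ xs-clique) =
    length≤degree (Unique.++⁺ op-xs-unique (AllPairs.map Adj⇒≢ xs-clique) disjoint)
                  (All.++⁺ (All.map⁺ (All.map (Adj-sym ∘ twin-adj a ∘ Adj-sym) a~xs)) a~xs)
    where
    twin-adj : ∀ w {x} → Adj x w → Adj (op x) w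
    twin-adj w {x} = Equivalence.to (proj₂ (twin x) w)
    op-xs-unique : Unique (map op xs)
    op-xs-unique = AllPairs.map⁺ (AllPairs.map (λ {x} {y} xy opx≡opy →
      irrefl (Equivalence.from (proj₂ (twin y) y) (subst (λ z → Adj z y) opx≡opy (twin-adj y xy))))
      xs-clique)
    disjoint : ∀ {v} → ¬ (v ∈ₗ map op xs × v ∈ₗ xs)
    disjoint (v∈op-xs , v∈xs) with ∈-map⁻ op v∈op-xs
    ... | x , x∈xs , refl =
      irrefl (twin-adj (op x) (AllPairs-lookup Adj-sym xs-clique x∈xs v∈xs (proj₁ (twin x))))

  K4⇒irreducible : k < 6 → VertexTransitive Γ → (Σ (Subset n) λ S → IsClique Γ S × ∣ S ∣ ≡ 4) →
                   Irreducible Γ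
  K4⇒irreducible k<6 vt (S , S-clique , ∣S∣≡4) reducible
    with elements S | trans (length-elements S) ∣S∣≡4 | elements-clique S-clique
  ... | _ ∷ _ ∷ _ ∷ _ ∷ [] | refl | K4 =
    <⇒≱ k<6 (twin-doubled-clique-bound (proj₁ ∘ twins) (proj₂ ∘ twins) K4)
    where
    twins : ∀ a → ∃[ a' ] (a ≢ a' × OpenTwins a a')
    twins = reducible⇒everywhere-OpenTwins vt reducible

module IndependentSets (Γ : Graph) where
  open Graph Γ renaming (sym to Adj-sym)

  independent-∪⁅⁆ : ∀ {S v} → IsIndependent Γ S → (∀ u → u ∈ S → ¬ Adj v u) → IsIndependent Γ (S ∪ ⁅ v ⁆)
  independent-∪⁅⁆ {S} {v} S-ind v≁S u w u∈ w∈ with x∈p∪q⁻ S ⁅ v ⁆ u∈ | x∈p∪q⁻ S ⁅ v ⁆ w∈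
  ... | inj₁ u∈S | inj₁ w∈S = S-ind u w u∈S w∈S
  ... | inj₁ u∈S | inj₂ w∈v = v≁S u u∈S ∘ Adj-sym ∘ subst (Adj u) (x∈⁅y⁆⇒x≡y v w∈v)
  ... | inj₂ u∈v | inj₁ w∈S = v≁S w w∈S ∘ subst (λ x → Adj x w) (x∈⁅y⁆⇒x≡y v u∈v)
  ... | inj₂ u∈v | inj₂ w∈v = irrefl ∘ subst₂ Adj (x∈⁅y⁆⇒x≡y v u∈v) (x∈⁅y⁆⇒x≡y v w∈v)

  Dominated : Subset n → Fin n → Set
  Dominated I w = w ∈ I ⊎ ∃[ u ] (u ∈ I × Adj w u)

  greedy-extension : ∀ vs S → IsIndependent Γ S →
                     ∃[ I ] (IsIndependent Γ I × S ⊆ I × (∀ {w} → w ∈ₗ vs → Dominated I w))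
  greedy-extension [] S S-ind = S , S-ind , id , λ ()
  greedy-extension (v ∷ vs) S S-ind with any? (λ u → (u ∈? S) ×-dec adj? v u)
  ... | yes (u , u∈S , vu) with greedy-extension vs S S-ind
  ...   | I , I-ind , S⊆I , dom =
    I , I-ind , S⊆I , λ { (here refl) → inj₂ (u , S⊆I u∈S , vu) ; (there w∈) → dom w∈ }
  greedy-extension (v ∷ vs) S S-ind | no v≁S
    with greedy-extension vs (S ∪ ⁅ v ⁆) (independent-∪⁅⁆ S-ind λ u u∈S vu → v≁S (u , u∈S , vu))
  ... | I , I-ind , S+v⊆I , dom =
    I , I-ind , S+v⊆I ∘ x∈p∪q⁺ ∘ inj₁ ,
    λ { (here refl) → inj₁ (S+v⊆I (x∈p∪q⁺ (inj₂ (x∈⁅x⁆ v)))) ; (there w∈) → dom w∈ }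

  maximal-extension : ∀ {S} → IsIndependent Γ S → ∃[ I ] (IsMaximalIndependent Γ I × S ⊆ I)
  maximal-extension {S} S-ind with greedy-extension (allFin n) S S-ind
  ... | I , I-ind , S⊆I , dom = I , (I-ind , maximal) , S⊆I
    where
    maximal : ∀ T → IsIndependent Γ T → I ⊆ T → T ⊆ I
    maximal T T-ind I⊆T {w} w∈T with dom (∈-allFin w)
    ... | inj₁ w∈I = w∈I
    ... | inj₂ (u , u∈I , wu) = ⊥-elim (T-ind w u w∈T (I⊆T u∈I) wu)

module StrongCliques (Γ : Graph) where
  open Graph Γ renaming (sym to Adj-sym)
  open IndependentSets Γ

  strong-clique-nonempty : ∀ {C} → IsStrongClique Γ C → ∃[ c ] (c ∈ C)
  strong-clique-nonempty (_ , strong) with maximal-extension {⊥} (λ u _ u∈⊥ → ⊥-elim (∉⊥ u∈⊥))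
  ... | I , I-max , _ with strong I I-max
  ...   | c , c∈C , _ = c , c∈C

  strong-clique-dominated⇒Adj : ∀ {C y z} → IsStrongClique Γ C → (∀ w → w ∈ C → Adj w y ⊎ Adj w z) → Adj y z
  strong-clique-dominated⇒Adj {C} {y} {z} (_ , strong) C~y∨z with adj? y z
  ... | yes yz = yz
  ... | no y≁z with maximal-extension yz-independent
    where
    y-independent : IsIndependent Γ ⁅ y ⁆
    y-independent u w u∈ w∈ = irrefl ∘ subst₂ Adj (x∈⁅y⁆⇒x≡y y u∈) (x∈⁅y⁆⇒x≡y y w∈)
    yz-independent : IsIndependent Γ (⁅ y ⁆ ∪ ⁅ z ⁆)
    yz-independent = independent-∪⁅⁆ y-independent λ u u∈ → y≁z ∘ Adj-sym ∘ subst (Adj z) (x∈⁅y⁆⇒x≡y y u∈)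
  ... | I , I-max@(I-ind , _) , yz⊆I with strong I I-max
  ...   | w , w∈C , w∈I with C~y∨z w w∈C
  ...     | inj₁ wy = ⊥-elim (I-ind w y w∈I (yz⊆I (x∈p∪q⁺ (inj₁ (x∈⁅x⁆ y)))) wy)
  ...     | inj₂ wz = ⊥-elim (I-ind w z w∈I (yz⊆I (x∈p∪q⁺ (inj₂ (x∈⁅x⁆ z)))) wz)

  strong-clique-criterion : ∀ {C} → IsClique Γ C →
    (∀ I → IsIndependent Γ I → (∀ v → v ∈ I → v ∉ C) → ∃[ c ] (c ∈ C × ∀ v → v ∈ I → ¬ Adj c v)) →
    IsStrongClique Γ C
  strong-clique-criterion {C} C-clique undominated = C-clique , strong
    where
    strong : ∀ I → IsMaximalIndependent Γ I → ∃[ v ] (v ∈ C × v ∈ I)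
    strong I (I-ind , I-max) with any? (λ v → (v ∈? C) ×-dec (v ∈? I))
    ... | yes meet = meet
    ... | no disjoint with undominated I I-ind (λ v v∈I v∈C → disjoint (v , v∈C , v∈I))
    ...   | c , c∈C , c≁I = ⊥-elim (disjoint (c , c∈C , I-max (I ∪ ⁅ c ⁆) (independent-∪⁅⁆ I-ind c≁I)
                                                      (x∈p∪q⁺ ∘ inj₁) (x∈p∪q⁺ (inj₂ (x∈⁅x⁆ c)))))

module _ (Γ H : Graph) {k : ℕ} (Γ-regular : Regular Γ k) (H-regular : Regular H k)
         (Γ-connected : Connected Γ) where
  private
    module Γ = Graph Γ
    module H = Graph H
  open Neighbourhood H using (neighbours; neighbours-unique; ∈-neighbours⁻)
  open RegularGraph Γ Γ-regular using (neighbours-exhausted)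

  injective-homomorphism⇒≅ : (f : Fin H.n → Fin Γ.n) → Fin H.n →
                             (∀ {i j} → H.Adj i j → Γ.Adj (f i) (f j)) → (∀ {i j} → f i ≡ f j → i ≡ j) →
                             Γ ≅ H
  injective-homomorphism⇒≅ f i₀ hom inj = mk↔ₛ′ g f (λ i → sym (inj (g-section (f i)))) (sym ∘ g-section) ,
                                         λ u v → mk⇔ (reflect u v) (preserve u v)
    where
    image-closed : ∀ i {w} → Γ.Adj (f i) w → ∃[ j ] (H.Adj i j × w ≡ f j)
    image-closed i fi~w with ∈-map⁻ f (neighbours-exhausted
        (Unique.map⁺ inj (neighbours-unique i))
        (All.map⁺ (All.tabulate (hom ∘ ∈-neighbours⁻)))
        (trans (length-map f (neighbours i)) (H-regular i))
        fi~w)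
    ... | j , j∈N , w≡fj = j , ∈-neighbours⁻ j∈N , w≡fj

    reach : ∀ {u w} → Reachable Γ u w → ∀ i → u ≡ f i → ∃[ j ] (w ≡ f j)
    reach here i u≡fi = i , u≡fi
    reach (step uv v⇝w) i refl with image-closed i uv
    ... | j , _ , v≡fj = reach v⇝w j v≡fj

    g : Fin Γ.n → Fin H.n
    g w = proj₁ (reach (Γ-connected (f i₀) w) i₀ refl)

    g-section : ∀ w → w ≡ f (g w)
    g-section w = proj₂ (reach (Γ-connected (f i₀) w) i₀ refl)

    reflect : ∀ u v → Γ.Adj u v → H.Adj (g u) (g v)
    reflect u v uv with image-closed (g u) (subst (λ x → Γ.Adj x v) (g-section u) uv)
    ... | j , gu~j , v≡fj = subst (H.Adj (g u)) (inj (trans (sym v≡fj) (g-section v))) gu~j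

    preserve : ∀ u v → H.Adj (g u) (g v) → Γ.Adj u v
    preserve u v = subst₂ Γ.Adj (sym (g-section u)) (sym (g-section v)) ∘ hom

preimage : ∀ {m n} → (Fin m → Fin n) → Subset n → Subset m
preimage g S = Vec.tabulate (λ v → Vec.lookup S (g v))

∈-preimage⁺ : ∀ {m n} {g : Fin m → Fin n} {S v} → g v ∈ S → v ∈ preimage g S
∈-preimage⁺ {v = v} gv∈S = lookup⇒[]= v _ (trans (lookup∘tabulate _ v) ([]=⇒lookup gv∈S))

∈-preimage⁻ : ∀ {m n} {g : Fin m → Fin n} {S v} → v ∈ preimage g S → g v ∈ S
∈-preimage⁻ {g = g} {S} {v} v∈ = lookup⇒[]= (g v) S (trans (sym (lookup∘tabulate _ v)) ([]=⇒lookup v∈))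

≅-HasStrongClique : ∀ {G H} → G ≅ H → HasStrongClique H → HasStrongClique G
≅-HasStrongClique {G} {H} (φ , φ-adj) (C , C-clique , C-strong) = preimage to C , clique , strong
  where
  module G = Graph G
  module H = Graph H
  to : Fin G.n → Fin H.n
  to = Inverse.to φ
  from : Fin H.n → Fin G.n
  from = Inverse.from φ
  to-from : ∀ v → to (from v) ≡ v
  to-from = Inverse.strictlyInverseˡ φ
  from-to : ∀ v → from (to v) ≡ v
  from-to = Inverse.strictlyInverseʳ φ

  Adj-to : ∀ {u v} → G.Adj u v → H.Adj (to u) (to v)
  Adj-to {u} {v} = Equivalence.to (φ-adj u v)
  Adj-from : ∀ {u v} → H.Adj u v → G.Adj (from u) (from v)
  Adj-from {u} {v} =
    Equivalence.from (φ-adj (from u) (from v)) ∘ subst₂ H.Adj (sym (to-from u)) (sym (to-from v))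

  clique : IsClique G (preimage to C)
  clique u v u∈ v∈ u≢v = Equivalence.from (φ-adj u v)
    (C-clique _ _ (∈-preimage⁻ u∈) (∈-preimage⁻ v∈)
      λ eq → u≢v (trans (sym (from-to u)) (trans (cong from eq) (from-to v))))

  strong : ∀ I → IsMaximalIndependent G I → ∃[ v ] (v ∈ preimage to C × v ∈ I)
  strong I (I-ind , I-max) with C-strong (preimage from I) (J-ind , J-max)
    where
    J-ind : IsIndependent H (preimage from I)
    J-ind u v u∈ v∈ = I-ind _ _ (∈-preimage⁻ u∈) (∈-preimage⁻ v∈) ∘ Adj-from
    J-max : ∀ T → IsIndependent H T → preimage from I ⊆ T → T ⊆ preimage from I
    J-max T T-ind J⊆T {v} v∈T =
      ∈-preimage⁺ (I-max (preimage to T) T′-ind I⊆T′ (∈-preimage⁺ (subst (_∈ T) (sym (to-from v)) v∈T)))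
      where
      T′-ind : IsIndependent G (preimage to T)
      T′-ind u w u∈ w∈ = T-ind _ _ (∈-preimage⁻ u∈) (∈-preimage⁻ w∈) ∘ Adj-to
      I⊆T′ : I ⊆ preimage to T
      I⊆T′ {u} u∈I = ∈-preimage⁺ (J⊆T (∈-preimage⁺ (subst (_∈ I) (sym (from-to u)) u∈I)))
  ... | v , v∈C , v∈J = from v , ∈-preimage⁺ (subst (_∈ C) (sym (to-from v)) v∈C) , ∈-preimage⁻ v∈J

module C4[K2]-Properties where
  open Graph C4[K2]
  open StrongCliques C4[K2] using (strong-clique-criterion)

  C4[K2]-regular : Regular C4[K2] 5
  C4[K2]-regular = from-yes (all? λ v → degree C4[K2] v ℕ.≟ 5)

  -- Vertex i of C4[K2] lies in the block over vertex ⌊i/2⌋ of C4.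
  blocks01 blocks2 : Subset 8
  blocks01 = inside Vec.∷ inside Vec.∷ inside Vec.∷ inside Vec.∷
             outside Vec.∷ outside Vec.∷ outside Vec.∷ outside Vec.∷ Vec.[]
  blocks2 = outside Vec.∷ outside Vec.∷ outside Vec.∷ outside Vec.∷
            inside Vec.∷ inside Vec.∷ outside Vec.∷ outside Vec.∷ Vec.[]

  blocks01-clique : IsClique C4[K2] blocks01
  blocks01-clique = from-yes (all? λ u → all? λ v →
    (u ∈? blocks01) →-dec (v ∈? blocks01) →-dec ¬? (u ≟ v) →-dec adj? u v)

  blocks2-dominates : ∀ v u → v ∈ blocks2 → u ∉ blocks01 → ¬ Adj v u → ¬ Adj (# 0) u
  blocks2-dominates = from-yes (all? λ v → all? λ u →
    (v ∈? blocks2) →-dec ¬? (u ∈? blocks01) →-dec ¬? (adj? v u) →-dec ¬? (adj? (# 0) u))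

  outside-blocks2 : ∀ u → u ∉ blocks01 → u ∉ blocks2 → ¬ Adj (# 2) u
  outside-blocks2 = from-yes (all? λ u →
    ¬? (u ∈? blocks01) →-dec ¬? (u ∈? blocks2) →-dec ¬? (adj? (# 2) u))

  C4[K2]-HasStrongClique : HasStrongClique C4[K2]
  C4[K2]-HasStrongClique = blocks01 , strong-clique-criterion blocks01-clique undominated
    where
    undominated : ∀ I → IsIndependent C4[K2] I → (∀ v → v ∈ I → v ∉ blocks01) →
                  ∃[ c ] (c ∈ blocks01 × ∀ v → v ∈ I → ¬ Adj c v)
    undominated I I-ind I∩C=∅ with any? (λ v → (v ∈? I) ×-dec (v ∈? blocks2))
    ... | yes (v , v∈I , v∈B₂) =
      # 0 , Vec.here , λ u u∈I → blocks2-dominates v u v∈B₂ (I∩C=∅ u u∈I) (I-ind v u v∈I u∈I)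
    ... | no I∩B₂=∅ =
      # 2 , Vec.there (Vec.there Vec.here) ,
      λ u u∈I → outside-blocks2 u (I∩C=∅ u u∈I) (λ u∈B₂ → I∩B₂=∅ (u , u∈I , u∈B₂))

module LocallyUniversal (Γ : Graph) (regular : Regular Γ 5) (ω≤4 : ∀ S → IsClique Γ S → ∣ S ∣ ≤ 4)
                        (universal : ∀ v → LocalGraphHasUniversalVertex Γ v) where
  open Graph Γ renaming (sym to Adj-sym)
  open Neighbourhood Γ
  open ClosedTwins Γ
  open RegularGraph Γ regular
  open Cliques Γ
  open StrongCliques Γ using (strong-clique-nonempty; strong-clique-dominated⇒Adj)
  open C4[K2]-Properties using (C4[K2]-regular)

  no-5-clique : ∀ {a b c d e} → AllPairs Adj (a ∷ b ∷ c ∷ d ∷ e ∷ []) → Empty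
  no-5-clique K with clique-length≤ ω≤4 K
  ... | s≤s (s≤s (s≤s (s≤s ())))

  tw : Fin n → Fin n
  tw v = proj₁ (universal⇒closed-twin (universal v))

  tw-≢ : ∀ v → v ≢ tw v
  tw-≢ v = proj₁ (proj₂ (universal⇒closed-twin (universal v)))

  tw-≈ : ∀ v → v ≈ tw v
  tw-≈ v = proj₂ (proj₂ (universal⇒closed-twin (universal v)))

  Adj-tw : ∀ v → Adj v (tw v)
  Adj-tw v = ≈⇒≢⇒Adj (tw-≈ v) (tw-≢ v)

  -- N(v) = {a, b, c, d, e}; an edge from c to d or e would give a 5-clique with v, a, b, so the
  -- closed twin of c has nowhere to go.
  two-closed-twins-impossible : ∀ {v a b} → v ≈ a → Adj v a → v ≈ b → Adj v b → b ≢ a → Empty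
  two-closed-twins-impossible {v} {a} {b} v≈a va v≈b vb b≢a
    with fresh-neighbour ((b≢a ∷ []) ∷ [] ∷ []) (vb ∷ va ∷ []) (from-yes (2 <? 5))
  ... | c , vc , c∉
    with fresh-neighbour (c∉ ∷! (b≢a ∷ []) ∷ [] ∷ []) (vc ∷ vb ∷ va ∷ []) (from-yes (3 <? 5))
  ... | d , vd , d∉
    with fresh-neighbour (d∉ ∷! c∉ ∷! (b≢a ∷ []) ∷ [] ∷ []) (vd ∷ vc ∷ vb ∷ va ∷ []) (from-yes (4 <? 5))
  ... | e , ve , e∉ =
    tw-c-nowhere (neighbours-exhausted (e∉ ∷! d∉ ∷! c∉ ∷! (b≢a ∷ []) ∷ [] ∷ [])
                                       (ve ∷ vd ∷ vc ∷ vb ∷ va ∷ []) refl v~twc)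
    where
    c~w-impossible : ∀ {w} → Adj v w → w ∉ₗ c ∷ b ∷ a ∷ [] → ¬ Adj c w
    c~w-impossible {w} vw w∉ cw = no-5-clique
      ((va ∷ vb ∷ vc ∷ vw ∷ [])
      ∷ (≈-Adj v≈a vb (b≢a ∘ sym) ∷ ≈-Adj v≈a vc (∈-∉⇒≢ (there (here refl)) c∉)
        ∷ ≈-Adj v≈a vw (∈-∉⇒≢ (there (there (here refl))) w∉) ∷ [])
      ∷ (≈-Adj v≈b vc (∈-∉⇒≢ (here refl) c∉) ∷ ≈-Adj v≈b vw (∈-∉⇒≢ (there (here refl)) w∉) ∷ [])
      ∷ (cw ∷ []) ∷ [] ∷ [])
    d∉N[c] : d ∉N[ c ]
    d∉N[c] (inj₁ refl) = d∉ (here refl)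
    d∉N[c] (inj₂ cd) = c~w-impossible vd d∉ cd
    e∉N[c] : e ∉N[ c ]
    e∉N[c] (inj₁ refl) = e∉ (there (here refl))
    e∉N[c] (inj₂ ce) = c~w-impossible ve (e∉ ∘ there) ce
    c≉v : ¬ c ≈ v
    c≉v c≈v = d∉N[c] (∈N-resp-≈ (≈-sym c≈v) (inj₂ vd))
    v~twc : Adj v (tw c)
    v~twc = Adj-resp-≈ (c≉v ∘ ≈-sym) ≈-refl (tw-≈ c) vc
    tw-c-nowhere : tw c ∈ₗ e ∷ d ∷ c ∷ b ∷ a ∷ [] → Empty
    tw-c-nowhere (here twc≡e) = e∉N[c] (subst (_∈N[ c ]) twc≡e (≈⇒∈N (tw-≈ c)))
    tw-c-nowhere (there (here twc≡d)) = d∉N[c] (subst (_∈N[ c ]) twc≡d (≈⇒∈N (tw-≈ c)))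
    tw-c-nowhere (there (there (here twc≡c))) = tw-≢ c (sym twc≡c)
    tw-c-nowhere (there (there (there (here refl)))) = c≉v (≈-trans (tw-≈ c) (≈-sym v≈b))
    tw-c-nowhere (there (there (there (there (here refl))))) = c≉v (≈-trans (tw-≈ c) (≈-sym v≈a))

  closed-twin-unique : ∀ {v a b} → v ≈ a → v ≢ a → v ≈ b → v ≢ b → a ≡ b
  closed-twin-unique {a = a} {b} v≈a v≢a v≈b v≢b with a ≟ b
  ... | yes a≡b = a≡b
  ... | no a≢b =
    ⊥-elim (two-closed-twins-impossible v≈a (≈⇒≢⇒Adj v≈a v≢a) v≈b (≈⇒≢⇒Adj v≈b v≢b) (a≢b ∘ sym))

  ≈-cases : ∀ {v w} → w ≈ v → w ≡ v ⊎ w ≡ tw v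
  ≈-cases {v} {w} w≈v with w ≟ v
  ... | yes w≡v = inj₁ w≡v
  ... | no w≢v = inj₂ (closed-twin-unique (≈-sym w≈v) (w≢v ∘ sym) (tw-≈ v) (tw-≢ v))

  cases⇒≈ : ∀ {v w} → w ≡ v ⊎ w ≡ tw v → w ≈ v
  cases⇒≈ (inj₁ refl) = ≈-refl
  cases⇒≈ (inj₂ refl) = ≈-sym (tw-≈ _)

  ≢⇒≉ : ∀ {v w} → w ≢ v → w ≢ tw v → ¬ w ≈ v
  ≢⇒≉ w≢v w≢twv w≈v with ≈-cases w≈v
  ... | inj₁ w≡v = w≢v w≡v
  ... | inj₂ w≡twv = w≢twv w≡twv

  record Star (c : Fin n) : Set where
    field
      x y : Fin n
      c~x : Adj c x
      c~y : Adj c y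
      y∉N[x] : y ∉N[ x ]
      covered : ∀ {w} → Adj c w → w ≈ c ⊎ w ≈ x ⊎ w ≈ y

  Star-swap : ∀ {c} → Star c → Star c
  Star-swap s = record
    { x = y ; y = x ; c~x = c~y ; c~y = c~x ; y∉N[x] = ∉N-sym y∉N[x]
    ; covered = [ inj₁ , [ inj₂ ∘ inj₂ , inj₂ ∘ inj₁ ]′ ]′ ∘ covered }
    where open Star s

  star-around : ∀ {c x} → Adj c x → ¬ x ≈ c → Star c
  star-around {c} {x} c~x x≉c
    with fresh-neighbour {xs = tw x ∷ x ∷ tw c ∷ []}
           ((tw-≢ x ∘ sym ∷ ≉⇒≢ x≉c (tw-≈ x) (tw-≈ c) ∷ []) ∷ (≉⇒≢ x≉c ≈-refl (tw-≈ c) ∷ []) ∷ [] ∷ [])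
           (c~x′ ∷ c~x ∷ Adj-tw c ∷ []) (from-yes (3 <? 5))
    where
    c~x′ : Adj c (tw x)
    c~x′ = Adj-resp-≈ (x≉c ∘ ≈-sym) ≈-refl (tw-≈ x) c~x
  ... | y , c~y , y∉ =
    record { x = x ; y = y ; c~x = c~x ; c~y = c~y ; y∉N[x] = y∉N[x] ; covered = covered }
    where
    y≉x : ¬ y ≈ x
    y≉x = ≢⇒≉ (∈-∉⇒≢ (there (here refl)) y∉ ∘ sym) (∈-∉⇒≢ (here refl) y∉ ∘ sym)
    y≉c : ¬ y ≈ c
    y≉c = ≢⇒≉ (Adj⇒≢ c~y ∘ sym) (∈-∉⇒≢ (there (there (here refl))) y∉ ∘ sym)
    c~tw : ∀ {w} → ¬ w ≈ c → Adj c w → Adj c (tw w)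
    c~tw w≉c = Adj-resp-≈ (w≉c ∘ ≈-sym) ≈-refl (tw-≈ _)
    tw-c~ : ∀ {w} → ¬ w ≈ c → Adj c w → Adj (tw c) w
    tw-c~ w≉c = Adj-resp-≈ (w≉c ∘ ≈-sym) (tw-≈ c) ≈-refl
    neighbours-of-c : ∀ {w} → Adj c w → w ∈ₗ tw y ∷ y ∷ tw x ∷ x ∷ tw c ∷ []
    neighbours-of-c = neighbours-exhausted
      ((tw-≢ y ∘ sym ∷ ≉⇒≢ y≉x (tw-≈ y) (tw-≈ x) ∷ ≉⇒≢ y≉x (tw-≈ y) ≈-refl ∷ ≉⇒≢ y≉c (tw-≈ y) (tw-≈ c) ∷ [])
        ∷ y∉ ∷! (tw-≢ x ∘ sym ∷ ≉⇒≢ x≉c (tw-≈ x) (tw-≈ c) ∷ []) ∷ (≉⇒≢ x≉c ≈-refl (tw-≈ c) ∷ []) ∷ [] ∷ [])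
      (c~tw y≉c c~y ∷ c~y ∷ c~tw x≉c c~x ∷ c~x ∷ Adj-tw c ∷ []) refl
    covered : ∀ {w} → Adj c w → w ≈ c ⊎ w ≈ x ⊎ w ≈ y
    covered cw with neighbours-of-c cw
    ... | here refl = inj₂ (inj₂ (≈-sym (tw-≈ y)))
    ... | there (here refl) = inj₂ (inj₂ ≈-refl)
    ... | there (there (here refl)) = inj₂ (inj₁ (≈-sym (tw-≈ x)))
    ... | there (there (there (here refl))) = inj₂ (inj₁ ≈-refl)
    ... | there (there (there (there (here refl)))) = inj₁ (≈-sym (tw-≈ c))
    y∉N[x] : y ∉N[ x ]
    y∉N[x] (inj₁ refl) = y≉x ≈-refl
    y∉N[x] (inj₂ x~y) = no-5-clique
      ((Adj-tw c ∷ c~x ∷ c~tw x≉c c~x ∷ c~y ∷ [])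
      ∷ (tw-c~ x≉c c~x ∷ tw-c~ (x≉c ∘ ≈-trans (tw-≈ x)) (c~tw x≉c c~x) ∷ tw-c~ y≉c c~y ∷ [])
      ∷ (Adj-tw x ∷ x~y ∷ [])
      ∷ (Adj-resp-≈ (y≉x ∘ ≈-sym) (tw-≈ x) ≈-refl x~y ∷ [])
      ∷ [] ∷ [])

  star : ∀ c → Star c
  star c with fresh-neighbour {xs = tw c ∷ []} ([] ∷ []) (Adj-tw c ∷ []) (from-yes (1 <? 5))
  ... | x , c~x , x∉ = star-around c~x (≢⇒≉ (Adj⇒≢ c~x ∘ sym) (x∉ ∘ here))

  layer : Fin 2 → Fin n → Fin n
  layer zero v = v
  layer (suc zero) v = tw v

  layer-≈ : ∀ x v → v ≈ layer x v
  layer-≈ zero v = ≈-refl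
  layer-≈ (suc zero) v = tw-≈ v

  layer-Adj : ∀ {x y} v → x ≢ y → Adj (layer x v) (layer y v)
  layer-Adj {zero} {zero} v x≢y = ⊥-elim (x≢y refl)
  layer-Adj {zero} {suc zero} v _ = Adj-tw v
  layer-Adj {suc zero} {zero} v _ = Adj-sym (Adj-tw v)
  layer-Adj {suc zero} {suc zero} v x≢y = ⊥-elim (x≢y refl)

  layer-injective : ∀ {x y} v → layer x v ≡ layer y v → x ≡ y
  layer-injective {zero} {zero} v _ = refl
  layer-injective {zero} {suc zero} v v≡twv = ⊥-elim (tw-≢ v v≡twv)
  layer-injective {suc zero} {zero} v twv≡v = ⊥-elim (tw-≢ v (sym twv≡v))
  layer-injective {suc zero} {suc zero} v _ = refl

  module _ (connected : Connected Γ) {a b c d} (ab : Adj a b) (bc : Adj b c) (cd : Adj c d) (da : Adj d a)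
           (c∉N[a] : c ∉N[ a ]) (d∉N[b] : d ∉N[ b ]) where

    square : Fin 4 → Fin n
    square zero = a
    square (suc zero) = b
    square (suc (suc zero)) = c
    square (suc (suc (suc zero))) = d

    opposite : Fin 4 → Fin 4
    opposite zero = # 2
    opposite (suc zero) = # 3
    opposite (suc (suc zero)) = # 0
    opposite (suc (suc (suc zero))) = # 1

    square-hom : ∀ {k l} → T (c4adj k l) → Adj (square k) (square l)
    square-hom {zero} {suc zero} _ = ab
    square-hom {zero} {suc (suc (suc zero))} _ = Adj-sym da
    square-hom {suc zero} {zero} _ = Adj-sym ab
    square-hom {suc zero} {suc (suc zero)} _ = bc
    square-hom {suc (suc zero)} {suc zero} _ = Adj-sym bc
    square-hom {suc (suc zero)} {suc (suc (suc zero))} _ = cd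
    square-hom {suc (suc (suc zero))} {suc (suc zero)} _ = Adj-sym cd
    square-hom {suc (suc (suc zero))} {zero} _ = da
    square-hom {zero} {zero} ()
    square-hom {zero} {suc (suc zero)} ()
    square-hom {suc zero} {suc zero} ()
    square-hom {suc zero} {suc (suc (suc zero))} ()
    square-hom {suc (suc zero)} {zero} ()
    square-hom {suc (suc zero)} {suc (suc zero)} ()
    square-hom {suc (suc (suc zero))} {suc zero} ()
    square-hom {suc (suc (suc zero))} {suc (suc (suc zero))} ()

    opposite-∉N : ∀ k → square (opposite k) ∉N[ square k ]
    opposite-∉N zero = c∉N[a]
    opposite-∉N (suc zero) = d∉N[b]
    opposite-∉N (suc (suc zero)) = ∉N-sym c∉N[a]
    opposite-∉N (suc (suc (suc zero))) = ∉N-sym d∉N[b]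

    opposite-∈N : ∀ k l → k ≢ l → square (opposite k) ∈N[ square l ]
    opposite-∈N zero zero k≢l = ⊥-elim (k≢l refl)
    opposite-∈N zero (suc zero) _ = inj₂ bc
    opposite-∈N zero (suc (suc zero)) _ = inj₁ refl
    opposite-∈N zero (suc (suc (suc zero))) _ = inj₂ (Adj-sym cd)
    opposite-∈N (suc zero) zero _ = inj₂ (Adj-sym da)
    opposite-∈N (suc zero) (suc zero) k≢l = ⊥-elim (k≢l refl)
    opposite-∈N (suc zero) (suc (suc zero)) _ = inj₂ cd
    opposite-∈N (suc zero) (suc (suc (suc zero))) _ = inj₁ refl
    opposite-∈N (suc (suc zero)) zero _ = inj₁ refl
    opposite-∈N (suc (suc zero)) (suc zero) _ = inj₂ (Adj-sym ab)
    opposite-∈N (suc (suc zero)) (suc (suc zero)) k≢l = ⊥-elim (k≢l refl)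
    opposite-∈N (suc (suc zero)) (suc (suc (suc zero))) _ = inj₂ da
    opposite-∈N (suc (suc (suc zero))) zero _ = inj₂ ab
    opposite-∈N (suc (suc (suc zero))) (suc zero) _ = inj₁ refl
    opposite-∈N (suc (suc (suc zero))) (suc (suc zero)) _ = inj₂ (Adj-sym bc)
    opposite-∈N (suc (suc (suc zero))) (suc (suc (suc zero))) k≢l = ⊥-elim (k≢l refl)

    -- square (opposite k) separates N[square k] from N[square l] for every l ≢ k.
    square-≈-injective : ∀ {k l} → square k ≈ square l → k ≡ l
    square-≈-injective {k} {l} k≈l with k ≟ l
    ... | yes k≡l = k≡l
    ... | no k≢l = ⊥-elim (opposite-∉N k (∈N-resp-≈ (≈-sym k≈l) (opposite-∈N k l k≢l)))

    blowup : Fin 4 × Fin 2 → Fin n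
    blowup (k , x) = layer x (square k)

    blowup-hom : ∀ u v → T (c4adj (proj₁ u) (proj₁ v)) ⊎ (proj₁ u ≡ proj₁ v × proj₂ u ≢ proj₂ v) →
                 Adj (blowup u) (blowup v)
    blowup-hom (k , x) (l , y) (inj₁ kl) =
      Adj-resp-≈ k≉l (layer-≈ x (square k)) (layer-≈ y (square l)) (square-hom kl)
      where
      k≉l : ¬ square k ≈ square l
      k≉l k≈l = Graph.irrefl C4 (subst (T ∘ c4adj k) (sym (square-≈-injective k≈l)) kl)
    blowup-hom (k , x) (_ , y) (inj₂ (refl , x≢y)) = layer-Adj (square k) x≢y

    blowup-injective : ∀ u v → blowup u ≡ blowup v → u ≡ v
    blowup-injective (k , x) (l , y) eq with square-≈-injective
      (≈-trans (layer-≈ x (square k)) (subst (_≈ square l) (sym eq) (≈-sym (layer-≈ y (square l)))))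
    ... | refl = cong (k ,_) (layer-injective (square k) eq)

    induced-square⇒≅ : Γ ≅ C4[K2]
    induced-square⇒≅ = injective-homomorphism⇒≅ Γ C4[K2] regular C4[K2]-regular connected
      (blowup ∘ remQuot 2) (# 0) (λ {i} {j} → blowup-hom (remQuot 2 i) (remQuot 2 j)) remQuot-injective
      where
      remQuot-injective : ∀ {i j} → blowup (remQuot 2 i) ≡ blowup (remQuot 2 j) → i ≡ j
      remQuot-injective {i} {j} eq = trans (sym (combine-remQuot {4} 2 i))
        (trans (cong (uncurry combine) (blowup-injective (remQuot 2 i) (remQuot 2 j) eq))
               (combine-remQuot {4} 2 j))

  strong-clique-avoiding-side⇒≅ : Connected Γ → ∀ {C c} → IsStrongClique Γ C → c ∈ C → (s : Star c) →
                                    (∀ w → w ∈ C → ¬ w ≈ Star.y s) → Γ ≅ C4[K2]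
  strong-clique-avoiding-side⇒≅ connected {C} {c} C-strong@(C-clique , _) c∈C s C∩[y]=∅
    with fresh-neighbour {xs = tw x ∷ c ∷ tw c ∷ []}
           ((≉⇒≢ x≉c (tw-≈ x) ≈-refl ∷ ≉⇒≢ x≉c (tw-≈ x) (tw-≈ c) ∷ []) ∷ (tw-≢ c ∷ []) ∷ [] ∷ [])
           (Adj-tw x ∷ Adj-sym c~x ∷ Adj-resp-≈ x≉c ≈-refl (tw-≈ c) (Adj-sym c~x) ∷ []) (from-yes (3 <? 5))
    where
    open Star s
    x≉c : ¬ x ≈ c
    x≉c x≈c = y∉N[x] (∈N-resp-≈ (≈-sym x≈c) (inj₂ c~y))
  ... | z , x~z , z∉ = induced-square⇒≅ connected c~x x~z (Adj-sym y~z) (Adj-sym c~y) z∉N[c] y∉N[x]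
    where
    open Star s
    z∉N[c] : z ∉N[ c ]
    z∉N[c] (inj₁ refl) = z∉ (there (here refl))
    z∉N[c] (inj₂ c~z) with covered c~z
    ... | inj₁ z≈c = [ z∉ ∘ there ∘ here , z∉ ∘ there ∘ there ∘ here ]′ (≈-cases z≈c)
    ... | inj₂ (inj₁ z≈x) = [ Adj⇒≢ x~z ∘ sym , z∉ ∘ here ]′ (≈-cases z≈x)
    ... | inj₂ (inj₂ z≈y) = ∉N-resp-≈ ≈-refl (≈-sym z≈y) y∉N[x] (inj₂ x~z)
    c≉y : ¬ c ≈ y
    c≉y c≈y = y∉N[x] (∈N-sym (∈N-resp-≈ c≈y (inj₂ c~x)))
    x≉z : ¬ x ≈ z
    x≉z x≈z = z∉N[c] (∈N-sym (∈N-resp-≈ x≈z (inj₂ (Adj-sym c~x))))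
    dominated : ∀ w → w ∈ C → Adj w y ⊎ Adj w z
    dominated w w∈C with w ≟ c
    ... | yes refl = inj₁ c~y
    ... | no w≢c with covered (C-clique c w c∈C w∈C (w≢c ∘ sym))
    ...   | inj₁ w≈c = inj₁ (Adj-resp-≈ c≉y (≈-sym w≈c) ≈-refl c~y)
    ...   | inj₂ (inj₁ w≈x) = inj₂ (Adj-resp-≈ x≉z (≈-sym w≈x) ≈-refl x~z)
    ...   | inj₂ (inj₂ w≈y) = ⊥-elim (C∩[y]=∅ w w∈C w≈y)
    y~z : Adj y z
    y~z = strong-clique-dominated⇒Adj C-strong dominated

  clique-avoids-a-side : ∀ {C c} → IsClique Γ C → (s : Star c) →
                         (∀ w → w ∈ C → ¬ w ≈ Star.y s) ⊎ (∀ w → w ∈ C → ¬ w ≈ Star.x s)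
  clique-avoids-a-side {C} C-clique s with any? (λ w → (w ∈? C) ×-dec ((w ≟ y) ⊎-dec (w ≟ tw y)))
    where open Star s
  ... | no C∩[y]=∅ = inj₁ λ w w∈C w≈y → C∩[y]=∅ (w , w∈C , ≈-cases w≈y)
  ... | yes (w , w∈C , w∈[y]) = inj₂ λ u u∈C u≈x →
        ∉N-resp-≈ (≈-sym u≈x) (≈-sym (cases⇒≈ w∈[y])) y∉N[x] (clique-∈N C-clique u∈C w∈C)
    where open Star s

  strong-clique⇒≅ : Connected Γ → HasStrongClique Γ → Γ ≅ C4[K2]
  strong-clique⇒≅ connected (C , C-strong@(C-clique , _)) with strong-clique-nonempty C-strong
  ... | c , c∈C = [ strong-clique-avoiding-side⇒≅ connected C-strong c∈C (star c)
                  , strong-clique-avoiding-side⇒≅ connected C-strong c∈C (Star-swap (star c)) ]′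
                  (clique-avoids-a-side C-clique (star c))

lemma5p6 : (Γ : Graph) → Connected Γ → Regular Γ 5 → VertexTransitive Γ → CliqueNumber Γ 4 →
    Irreducible Γ × ((∀ v → LocalGraphHasUniversalVertex Γ v) → (HasStrongClique Γ ⇔ (Γ ≅ C4[K2])))
lemma5p6 Γ connected regular vt (K4 , ω≤4) =
  K4⇒irreducible (from-yes (5 <? 6)) vt K4 ,
  λ universal → mk⇔ (LocallyUniversal.strong-clique⇒≅ Γ regular ω≤4 universal connected)
                    (λ Γ≅C4[K2] → ≅-HasStrongClique {Γ} {C4[K2]} Γ≅C4[K2] C4[K2]-HasStrongClique)
  where
  open RegularGraph Γ regular using (K4⇒irreducible)
  open C4[K2]-Properties using (C4[K2]-HasStrongClique)
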